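{- Let $\{c_n\}_{n\geq1}$ and $\{b_n\}_{n\geq1}$ be sequences of positive integers with $b_n\geq c_n$ for all $n$. Then for any $n\geq2$ and any $1\leq k\leq n-1$, $$\frac{\langle b_1,\ldots,b_n\rangle}{\langle c_1,\ldots,c_n\rangle}\geq 1+\frac{\langle b_1,\ldots,b_k\rangle-\langle c_1,\ldots,c_k\rangle+\bigl(\langle b_1,\ldots,b_{k-1}\rangle-\langle c_1,\ldots,c_{k-1}\rangle\bigr)\frac{1}{c_{k+1}+1}}{\langle c_1,\ldots,c_k\rangle+\langle c_1,\ldots,c_{k-1}\rangle\frac{1}{c_{k+1}}}.$$
   Context: $\langle a_1,\ldots,a_n\rangle$ denotes the continuant, i.e. the denominator $q_n$ of the continued fraction $[a_1,\ldots,a_n]=1/(a_1+1/(\cdots+1/a_n))$, computed by $q_{ -1}=0$, $q_0=1$, $q_j=a_jq_{j-1}+q_{j-2}$. The empty continuant (when $k=1$, $\langle b_1,\ldots,b_0\rangle$ and $\langle c_1,\ldots,c_0\rangle$) equals $1$. -}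

module Defs where

open import Data.Nat using (ℕ; zero; suc)
import Data.Nat as ℕ
open import Data.Rational using (ℚ; 0ℚ; _÷_; ≢-nonZero)
open import Data.Rational.Properties using (_≟_)
open import Relation.Nullary using (yes; no)
open import Data.Product using (_×_; _,_; proj₁)

-- Sequences are functions ℕ → ℕ; the paper's a_i is  a i  for i ≥ 1
-- (the value a 0 is irrelevant and never used).

-- cont a m = ⟨a_1,…,a_m⟩, via q_{-1}=0, q_0=1, q_j = a_j q_{j-1} + q_{j-2}.
-- contPair a m = (q_m , q_{m-1})
contPair : (ℕ → ℕ) → ℕ → ℕ × ℕ
contPair a zero = 1 , 0
contPair a (suc j) with contPair a j
... | (q , q') = a (suc j) ℕ.* q ℕ.+ q' , q

cont : (ℕ → ℕ) → ℕ → ℕ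
cont a m = proj₁ (contPair a m)

-- total division on ℚ (x / 0 := 0); only ever applied to positive
-- denominators under the hypotheses of the statement.
_÷₀_ : ℚ → ℚ → ℚ
p ÷₀ q with q ≟ 0ℚ
... | yes _ = 0ℚ
... | no q≢0 = _÷_ p q {{≢-nonZero q≢0}}

-- Write g = ⟨c_1,…,c_k⟩, g′ = ⟨c_1,…,c_{k-1}⟩, p, p′ likewise for b, and γ = c_{k+1}.  Splitting the
-- recurrence at k gives ⟨c_1,…,c_n⟩ = g X + g′ Y with X = ⟨c_{k+1},…,c_n⟩, Y = ⟨c_{k+2},…,c_n⟩, and since
-- continuants are monotone in their entries, ⟨b_1,…,b_n⟩ ≥ p X + p′ Y.  Hence ⟨b⟩/⟨c⟩ ≥ 1 + (P X + Q Y)/(g X + g′ Y)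
-- with P = p - g ≥ 0 and Q = p′ - g′ ≥ 0.  Finally γ Y ≤ X ≤ (γ + 1) Y, which bounds this numerator below by
-- (P + Q/(γ+1)) X and the denominator above by (g + g′/γ) X.
module Submission where

open import Defs
open import Data.Product using (_×_; _,_; proj₁; proj₂)
open import Relation.Binary.PropositionalEquality

module Continuant where
  open import Data.Nat using (ℕ; zero; suc; _+_; _*_; _∸_; _≤_; z≤n; s≤s; >-nonZero)
  open import Data.Nat.Properties
  open import Data.Nat.Tactic.RingSolver using (solve-∀)

  step : ℕ → ℕ × ℕ → ℕ × ℕ
  step x (q , q′) = x * q + q′ , q

  contPairFrom : (ℕ → ℕ) → (k t : ℕ) → ℕ × ℕ → ℕ × ℕ
  contPairFrom a k zero    v = v
  contPairFrom a k (suc t) v = step (a (suc (t + k))) (contPairFrom a k t v)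

  contPair-+ : ∀ a k t → contPair a (t + k) ≡ contPairFrom a k t (contPair a k)
  contPair-+ a k zero    = refl
  contPair-+ a k (suc t) = cong (step (a (suc (t + k)))) (contPair-+ a k t)

  contPairFrom-suc : ∀ a k t v →
    contPairFrom a k (suc t) v ≡ contPairFrom a (suc k) t (step (a (suc k)) v)
  contPairFrom-suc a k zero    v = refl
  contPairFrom-suc a k (suc t) v =
    cong₂ step (cong (λ i → a (suc i)) (sym (+-suc t k))) (contPairFrom-suc a k t v)

  combine : ℕ → ℕ → ℕ × ℕ → ℕ × ℕ → ℕ × ℕ
  combine x x′ (u , u′) (v , v′) = x * u + x′ * v , x * u′ + x′ * v′

  step-combine : ∀ α x x′ u v → step α (combine x x′ u v) ≡ combine x x′ (step α u) (step α v)
  step-combine α x x′ (u , u′) (v , v′) = cong (_, x * u + x′ * v) (identity α x x′ u u′ v v′)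
    where
    identity : ∀ α x x′ u u′ v v′ →
      α * (x * u + x′ * v) + (x * u′ + x′ * v′) ≡ x * (α * u + u′) + x′ * (α * v + v′)
    identity = solve-∀

  contPairFrom-combine : ∀ a k t x x′ u v →
    contPairFrom a k t (combine x x′ u v) ≡ combine x x′ (contPairFrom a k t u) (contPairFrom a k t v)
  contPairFrom-combine a k zero    x x′ u v = refl
  contPairFrom-combine a k (suc t) x x′ u v =
    trans (cong (step α) (contPairFrom-combine a k t x x′ u v))
          (step-combine α x x′ (contPairFrom a k t u) (contPairFrom a k t v))
    where α = a (suc (t + k))

  pair-combine : ∀ x x′ → (x , x′) ≡ combine x x′ (1 , 0) (0 , 1)
  pair-combine x x′ = cong₂ _,_ (identity x x′) (identity′ x x′)
    where
    identity : ∀ x x′ → x ≡ x * 1 + x′ * 0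
    identity = solve-∀
    identity′ : ∀ x x′ → x′ ≡ x * 0 + x′ * 1
    identity′ = solve-∀

  -- ⟨a_{k+1},…,a_{k+t}⟩ and ⟨a_{k+2},…,a_{k+t}⟩
  tailCont tailCont′ : (ℕ → ℕ) → (k t : ℕ) → ℕ
  tailCont  a k t = proj₁ (contPairFrom a k t (1 , 0))
  tailCont′ a k t = proj₁ (contPairFrom a k t (0 , 1))

  contPairFrom-linear : ∀ a k t x x′ →
    proj₁ (contPairFrom a k t (x , x′)) ≡ x * tailCont a k t + x′ * tailCont′ a k t
  contPairFrom-linear a k t x x′ = cong proj₁ (begin
    contPairFrom a k t (x , x′)                        ≡⟨ cong (contPairFrom a k t) (pair-combine x x′) ⟩
    contPairFrom a k t (combine x x′ (1 , 0) (0 , 1))  ≡⟨ contPairFrom-combine a k t x x′ _ _ ⟩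
    combine x x′ (contPairFrom a k t (1 , 0)) (contPairFrom a k t (0 , 1)) ∎)
    where open ≡-Reasoning

  cont-+ : ∀ a k t → cont a (t + k) ≡
    proj₁ (contPair a k) * tailCont a k t + proj₂ (contPair a k) * tailCont′ a k t
  cont-+ a k t = trans (cong proj₁ (contPair-+ a k t)) (contPairFrom-linear a k t _ _)

  tailCont-suc : ∀ a k s →
    tailCont a k (suc s) ≡ a (suc k) * tailCont a (suc k) s + tailCont′ a (suc k) s
  tailCont-suc a k s = begin
    tailCont a k (suc s)                                                 ≡⟨ cong proj₁ (contPairFrom-suc a k s (1 , 0)) ⟩
    proj₁ (contPairFrom a (suc k) s (α * 1 + 0 , 1))                     ≡⟨ contPairFrom-linear a (suc k) s _ _ ⟩
    (α * 1 + 0) * tailCont a (suc k) s + 1 * tailCont′ a (suc k) s       ≡⟨ identity α _ _ ⟩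
    α * tailCont a (suc k) s + tailCont′ a (suc k) s                     ∎
    where
    open ≡-Reasoning
    α = a (suc k)
    identity : ∀ α X Y → (α * 1 + 0) * X + 1 * Y ≡ α * X + Y
    identity = solve-∀

  tailCont′-suc : ∀ a k s → tailCont′ a k (suc s) ≡ tailCont a (suc k) s
  tailCont′-suc a k s = begin
    tailCont′ a k (suc s)                                          ≡⟨ cong proj₁ (contPairFrom-suc a k s (0 , 1)) ⟩
    proj₁ (contPairFrom a (suc k) s (α * 0 + 1 , 0))               ≡⟨ contPairFrom-linear a (suc k) s _ _ ⟩
    (α * 0 + 1) * tailCont a (suc k) s + 0 * tailCont′ a (suc k) s ≡⟨ identity α _ (tailCont′ a (suc k) s) ⟩
    tailCont a (suc k) s                                           ∎
    where
    open ≡-Reasoning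
    α = a (suc k)
    identity : ∀ α X Y → (α * 0 + 1) * X + 0 * Y ≡ X
    identity = solve-∀

  Positive : (ℕ → ℕ) → Set
  Positive a = ∀ i → 1 ≤ i → 1 ≤ a i

  _≼_ : (ℕ → ℕ) → (ℕ → ℕ) → Set
  a ≼ a′ = ∀ i → 1 ≤ i → a i ≤ a′ i

  tailCont′≤tailCont : ∀ {a} → Positive a → ∀ k t → tailCont′ a k t ≤ tailCont a k t
  tailCont′≤tailCont         a>0 k zero    = z≤n
  tailCont′≤tailCont {a} a>0 k (suc s) = begin
    tailCont′ a k (suc s)                                     ≡⟨ tailCont′-suc a k s ⟩
    tailCont a (suc k) s                                      ≤⟨ m≤n*m _ α {{>-nonZero (a>0 (suc k) (s≤s z≤n))}} ⟩
    α * tailCont a (suc k) s                                  ≤⟨ m≤m+n _ _ ⟩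
    α * tailCont a (suc k) s + tailCont′ a (suc k) s          ≡⟨ tailCont-suc a k s ⟨
    tailCont a k (suc s)                                      ∎
    where
    open ≤-Reasoning
    α = a (suc k)

  tailCont-bounds : ∀ {a} → Positive a → ∀ k s →
    a (suc k) * tailCont′ a k (suc s) ≤ tailCont a k (suc s) ×
    tailCont a k (suc s) ≤ suc (a (suc k)) * tailCont′ a k (suc s)
  tailCont-bounds {a} a>0 k s = lower , upper
    where
    open ≤-Reasoning
    α = a (suc k)
    Y = tailCont a (suc k) s
    Z = tailCont′ a (suc k) s
    lower : α * tailCont′ a k (suc s) ≤ tailCont a k (suc s)
    lower = begin
      α * tailCont′ a k (suc s) ≡⟨ cong (α *_) (tailCont′-suc a k s) ⟩
      α * Y                     ≤⟨ m≤m+n _ _ ⟩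
      α * Y + Z                 ≡⟨ tailCont-suc a k s ⟨
      tailCont a k (suc s)      ∎
    upper : tailCont a k (suc s) ≤ suc α * tailCont′ a k (suc s)
    upper = begin
      tailCont a k (suc s)      ≡⟨ tailCont-suc a k s ⟩
      α * Y + Z                 ≤⟨ +-monoʳ-≤ (α * Y) (tailCont′≤tailCont a>0 (suc k) s) ⟩
      α * Y + Y                 ≡⟨ +-comm (α * Y) Y ⟩
      suc α * Y                 ≡⟨ cong (suc α *_) (tailCont′-suc a k s) ⟨
      suc α * tailCont′ a k (suc s) ∎

  infix 4 _≤₂_
  _≤₂_ : ℕ × ℕ → ℕ × ℕ → Set
  (u , u′) ≤₂ (v , v′) = u ≤ v × u′ ≤ v′

  step-mono : ∀ {x y u v} → x ≤ y → u ≤₂ v → step x u ≤₂ step y v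
  step-mono x≤y (u≤v , u′≤v′) = +-mono-≤ (*-mono-≤ x≤y u≤v) u′≤v′ , u≤v

  contPair-mono : ∀ {a a′} → a ≼ a′ → ∀ m → contPair a m ≤₂ contPair a′ m
  contPair-mono a≼a′ zero    = ≤-refl , ≤-refl
  contPair-mono a≼a′ (suc m) = step-mono (a≼a′ (suc m) (s≤s z≤n)) (contPair-mono a≼a′ m)

  contPairFrom-mono : ∀ {a a′ u v} → a ≼ a′ → ∀ k t → u ≤₂ v → contPairFrom a k t u ≤₂ contPairFrom a′ k t v
  contPairFrom-mono a≼a′ k zero    u≤v = u≤v
  contPairFrom-mono a≼a′ k (suc t) u≤v = step-mono (a≼a′ (suc (t + k)) (s≤s z≤n)) (contPairFrom-mono a≼a′ k t u≤v)

  cont-pos : ∀ {a} → Positive a → ∀ m → 1 ≤ cont a m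
  cont-pos a>0 zero    = ≤-refl
  cont-pos a>0 (suc m) = ≤-trans (*-mono-≤ (a>0 (suc m) (s≤s z≤n)) (cont-pos a>0 m)) (m≤m+n _ _)

  -- (P + Q/(γ+1)) / (g + g′/γ) = excessNum P Q γ / excessDen g g′ γ
  excessNum : (P Q γ : ℕ) → ℕ
  excessNum P Q γ = (P * suc γ + Q) * γ

  excessDen : (g g′ γ : ℕ) → ℕ
  excessDen g g′ γ = suc γ * (g * γ + g′)

  excessNum≤ : ∀ {γ X Y} g g′ P Q → γ * Y ≤ X → X ≤ suc γ * Y →
    excessNum P Q γ * (g * X + g′ * Y) ≤ (P * X + Q * Y) * excessDen g g′ γ
  excessNum≤ {γ} {X} {Y} g g′ P Q γY≤X X≤sγY = begin
    excessNum P Q γ * D                                     ≡⟨ split P Q γ D ⟩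
    P * suc γ * (γ * D) + Q * (γ * D)                       ≤⟨ +-mono-≤ (*-monoʳ-≤ (P * suc γ) lower) (*-monoʳ-≤ Q upper) ⟩
    P * suc γ * (X * (g * γ + g′)) + Q * (suc γ * Y * (g * γ + g′)) ≡⟨ merge P Q γ X Y g g′ ⟩
    (P * X + Q * Y) * excessDen g g′ γ                      ∎
    where
    open ≤-Reasoning
    D = g * X + g′ * Y
    lower : γ * D ≤ X * (g * γ + g′)
    lower = begin
      γ * D                       ≡⟨ identity γ X Y g g′ ⟩
      g * γ * X + g′ * (γ * Y)    ≤⟨ +-monoʳ-≤ (g * γ * X) (*-monoʳ-≤ g′ γY≤X) ⟩
      g * γ * X + g′ * X          ≡⟨ identity′ γ X g g′ ⟩
      X * (g * γ + g′)            ∎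
      where
      identity : ∀ γ X Y g g′ → γ * (g * X + g′ * Y) ≡ g * γ * X + g′ * (γ * Y)
      identity = solve-∀
      identity′ : ∀ γ X g g′ → g * γ * X + g′ * X ≡ X * (g * γ + g′)
      identity′ = solve-∀
    upper : γ * D ≤ suc γ * Y * (g * γ + g′)
    upper = begin
      γ * D                                  ≡⟨ identity γ X Y g g′ ⟩
      g * γ * X + γ * (g′ * Y)               ≤⟨ +-mono-≤ (*-monoʳ-≤ (g * γ) X≤sγY) (*-monoˡ-≤ (g′ * Y) (n≤1+n γ)) ⟩
      g * γ * (suc γ * Y) + suc γ * (g′ * Y) ≡⟨ identity′ γ Y g g′ ⟩
      suc γ * Y * (g * γ + g′)               ∎
      where
      identity : ∀ γ X Y g g′ → γ * (g * X + g′ * Y) ≡ g * γ * X + γ * (g′ * Y)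
      identity = solve-∀
      identity′ : ∀ γ Y g g′ → g * γ * (suc γ * Y) + suc γ * (g′ * Y) ≡ suc γ * Y * (g * γ + g′)
      identity′ = solve-∀
    split : ∀ P Q γ D → (P * suc γ + Q) * γ * D ≡ P * suc γ * (γ * D) + Q * (γ * D)
    split = solve-∀
    merge : ∀ P Q γ X Y g g′ →
      P * suc γ * (X * (g * γ + g′)) + Q * (suc γ * Y * (g * γ + g′)) ≡ (P * X + Q * Y) * (suc γ * (g * γ + g′))
    merge = solve-∀

  excess-bound : ∀ {γ X Y} g g′ P Q → γ * Y ≤ X → X ≤ suc γ * Y →
    (excessDen g g′ γ + excessNum P Q γ) * (g * X + g′ * Y) ≤ ((g + P) * X + (g′ + Q) * Y) * excessDen g g′ γ
  excess-bound {γ} {X} {Y} g g′ P Q γY≤X X≤sγY = begin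
    (E + N) * D            ≡⟨ *-distribʳ-+ D E N ⟩
    E * D + N * D          ≤⟨ +-monoʳ-≤ (E * D) (excessNum≤ g g′ P Q γY≤X X≤sγY) ⟩
    E * D + (P * X + Q * Y) * E ≡⟨ identity E g g′ P Q X Y ⟩
    ((g + P) * X + (g′ + Q) * Y) * E ∎
    where
    open ≤-Reasoning
    E = excessDen g g′ γ
    N = excessNum P Q γ
    D = g * X + g′ * Y
    identity : ∀ E g g′ P Q X Y → E * (g * X + g′ * Y) + (P * X + Q * Y) * E ≡ ((g + P) * X + (g′ + Q) * Y) * E
    identity = solve-∀

  tail-replace-≤ : ∀ {b c} → c ≼ b → ∀ k t →
    proj₁ (contPair b k) * tailCont c k t + proj₂ (contPair b k) * tailCont′ c k t ≤ cont b (t + k)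
  tail-replace-≤ {b} {c} c≼b k t = begin
    proj₁ (contPair b k) * tailCont c k t + proj₂ (contPair b k) * tailCont′ c k t ≡⟨ contPairFrom-linear c k t _ _ ⟨
    proj₁ (contPairFrom c k t (contPair b k))   ≤⟨ proj₁ (contPairFrom-mono c≼b k t (≤-refl , ≤-refl)) ⟩
    proj₁ (contPairFrom b k t (contPair b k))   ≡⟨ cong proj₁ (contPair-+ b k t) ⟨
    cont b (t + k)                              ∎
    where open ≤-Reasoning

  cont-excess-bound : ∀ {b c} → Positive c → c ≼ b → ∀ k t →
    let g = cont c k; g′ = proj₂ (contPair c k); γ = c (suc k)
        P = cont b k ∸ g; Q = proj₂ (contPair b k) ∸ g′; n = suc t + k
    in (excessDen g g′ γ + excessNum P Q γ) * cont c n ≤ cont b n * excessDen g g′ γ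
  cont-excess-bound {b} {c} c>0 c≼b k t = begin
    (E + excessNum P Q γ) * cont c n            ≡⟨ cong ((E + excessNum P Q γ) *_) (cont-+ c k (suc t)) ⟩
    (E + excessNum P Q γ) * (g * X + g′ * Y)    ≤⟨ excess-bound g g′ P Q γY≤X X≤sγY ⟩
    ((g + P) * X + (g′ + Q) * Y) * E            ≡⟨ cong₂ (λ p p′ → (p * X + p′ * Y) * E)
                                                         (m+[n∸m]≡n g≤p) (m+[n∸m]≡n g′≤p′) ⟩
    (cont b k * X + proj₂ (contPair b k) * Y) * E ≤⟨ *-monoˡ-≤ E (tail-replace-≤ c≼b k (suc t)) ⟩
    cont b n * E                                ∎
    where
    open ≤-Reasoning
    g = cont c k
    g′ = proj₂ (contPair c k)
    γ = c (suc k)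
    n = suc t + k
    X = tailCont c k (suc t)
    Y = tailCont′ c k (suc t)
    E = excessDen g g′ γ
    P = cont b k ∸ g
    Q = proj₂ (contPair b k) ∸ g′
    g≤p : g ≤ cont b k
    g≤p = proj₁ (contPair-mono c≼b k)
    g′≤p′ : g′ ≤ proj₂ (contPair b k)
    g′≤p′ = proj₂ (contPair-mono c≼b k)
    γY≤X : γ * Y ≤ X
    γY≤X = proj₁ (tailCont-bounds c>0 k t)
    X≤sγY : X ≤ suc γ * Y
    X≤sγY = proj₂ (tailCont-bounds c>0 k t)

module Fraction where
  open import Data.Nat as ℕ using (ℕ; suc; NonZero)
  import Data.Nat.Properties as ℕ
  open import Data.Nat.Tactic.RingSolver renaming (solve-∀ to ℕsolve)
  open import Data.Integer as ℤ using (+_)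
  import Data.Integer.Properties as ℤ
  open import Data.Integer.Tactic.RingSolver using (solve-∀)
  open import Data.Rational.Unnormalised using (ℚᵘ; _/_; _+_; _*_; _-_; _≃_; _≤_; *≡*; *≤*)
  open import Data.Rational.Unnormalised.Properties using (≃-trans)

  infix 8 _//_
  _//_ : (x d : ℕ) .{{_ : NonZero d}} → ℚᵘ
  x // d = + x / d

  //-cong : ∀ {x y} d e .{{_ : NonZero d}} .{{_ : NonZero e}} → x ℕ.* e ≡ y ℕ.* d → x // d ≃ y // e
  //-cong {x} {y} (suc d) (suc e) eq =
    *≡* (trans (sym (ℤ.pos-* x (suc e))) (trans (cong +_ eq) (ℤ.pos-* y (suc d))))

  //-mono : ∀ {x y} d e .{{_ : NonZero d}} .{{_ : NonZero e}} → x ℕ.* e ℕ.≤ y ℕ.* d → x // d ≤ y // e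
  //-mono {x} {y} (suc d) (suc e) le =
    *≤* (subst₂ ℤ._≤_ (ℤ.pos-* x (suc e)) (ℤ.pos-* y (suc d)) (ℤ.+≤+ le))

  +-// : ∀ x d y e .{{_ : NonZero d}} .{{_ : NonZero e}} →
    x // d + y // e ≃ ((x ℕ.* e ℕ.+ y ℕ.* d) // (d ℕ.* e)) {{ℕ.m*n≢0 d e}}
  +-// x (suc d) y (suc e) = *≡* (cong (ℤ._* (+ (suc d ℕ.* suc e))) (begin
    (+ x) ℤ.* (+ suc e) ℤ.+ (+ y) ℤ.* (+ suc d)  ≡⟨ cong₂ ℤ._+_ (ℤ.pos-* x (suc e)) (ℤ.pos-* y (suc d)) ⟨
    (+ (x ℕ.* suc e)) ℤ.+ (+ (y ℕ.* suc d))      ≡⟨ ℤ.pos-+ (x ℕ.* suc e) (y ℕ.* suc d) ⟨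
    + (x ℕ.* suc e ℕ.+ y ℕ.* suc d)              ∎))
    where open ≡-Reasoning

  *-// : ∀ x d y e .{{_ : NonZero d}} .{{_ : NonZero e}} →
    x // d * y // e ≃ ((x ℕ.* y) // (d ℕ.* e)) {{ℕ.m*n≢0 d e}}
  *-// x (suc d) y (suc e) = *≡* (cong (ℤ._* (+ (suc d ℕ.* suc e))) (sym (ℤ.pos-* x y)))

  -// : ∀ x y → (x ℕ.+ y) // 1 - x // 1 ≃ y // 1
  -// x y = *≡* (trans (cong (λ z → (z ℤ.* ℤ.1ℤ ℤ.+ ℤ.- (+ x) ℤ.* ℤ.1ℤ) ℤ.* ℤ.1ℤ) (ℤ.pos-+ x y))
                      (identity (+ x) (+ y)))
    where
    identity : ∀ x y → ((x ℤ.+ y) ℤ.* ℤ.1ℤ ℤ.+ ℤ.- x ℤ.* ℤ.1ℤ) ℤ.* ℤ.1ℤ ≡ y ℤ.* ℤ.1ℤ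
    identity = solve-∀

  +-//1 : ∀ x y d .{{_ : NonZero d}} → x // 1 + y // d ≃ (x ℕ.* d ℕ.+ y) // d
  +-//1 x y d = ≃-trans (+-// x 1 y d) (//-cong (1 ℕ.* d) d {{ℕ.m*n≢0 1 d}} (identity x y d))
    where
    identity : ∀ x y d → (x ℕ.* d ℕ.+ y ℕ.* 1) ℕ.* d ≡ (x ℕ.* d ℕ.+ y) ℕ.* (1 ℕ.* d)
    identity = ℕsolve

  *-1//  : ∀ x d .{{_ : NonZero d}} → x // 1 * 1 // d ≃ x // d
  *-1// x d = ≃-trans (*-// x 1 1 d) (//-cong (1 ℕ.* d) d {{ℕ.m*n≢0 1 d}} (identity x d))
    where
    identity : ∀ x d → x ℕ.* 1 ℕ.* d ≡ x ℕ.* (1 ℕ.* d)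
    identity = ℕsolve

open Continuant
open Fraction
open import Data.Nat using (ℕ; suc; _∸_; NonZero; >-nonZero; s≤s; z≤n)
import Data.Nat as ℕ
import Data.Nat.Properties as ℕ
open import Data.Nat.Tactic.RingSolver using (solve-∀)
open import Data.Integer using (+_)
open import Data.Rational using (ℚ; _≤_; _+_; _-_; -_; _*_; 1ℚ; 0ℚ; _/_; 1/_; toℚᵘ; _≟_; ≢-nonZero)
open import Data.Rational.Properties as ℚ
  using (toℚᵘ-cancel-≤; toℚᵘ-homo-+; toℚᵘ-homo-*; toℚᵘ-homo‿-; toℚᵘ-fromℚᵘ)
open import Data.Rational.Unnormalised as ℚᵘ using (_≃_; *≡*; 0ℚᵘ; 1ℚᵘ)
  renaming (_+_ to _+ᵘ_; _*_ to _*ᵘ_; _-_ to _-ᵘ_)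
open import Data.Rational.Unnormalised.Properties as ℚᵘ
  using (≃-trans; +-cong; +-congʳ; *-cong; *-congˡ; *-congʳ)
open import Relation.Nullary using (¬_; yes; no)
open import Data.Empty using (⊥-elim)

toℚᵘ-/1 : ∀ x → toℚᵘ ((+ x) / 1) ≃ x // 1
toℚᵘ-/1 x = toℚᵘ-fromℚᵘ (x // 1)

toℚᵘ-homo-sub : ∀ p q → toℚᵘ (p - q) ≃ toℚᵘ p -ᵘ toℚᵘ q
toℚᵘ-homo-sub p q = ≃-trans (toℚᵘ-homo-+ p (- q)) (+-congʳ (toℚᵘ p) (toℚᵘ-homo‿- q))

÷₀-*-cancel : ∀ p q → q ≢ 0ℚ → (p ÷₀ q) * q ≡ p
÷₀-*-cancel p q q≢0 with q ≟ 0ℚ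
... | yes q≡0 = ⊥-elim (q≢0 q≡0)
... | no q≢0′ = begin
  p * 1/ q * q     ≡⟨ ℚ.*-assoc p (1/ q) q ⟩
  p * (1/ q * q)   ≡⟨ cong (p *_) (ℚ.*-inverseˡ q) ⟩
  p * 1ℚ           ≡⟨ ℚ.*-identityʳ p ⟩
  p                ∎
  where
  open ≡-Reasoning
  instance _ = ≢-nonZero q≢0′

toℚᵘ-÷₀ : ∀ p q x d .{{_ : NonZero x}} .{{_ : NonZero d}} →
  toℚᵘ q ≃ x // d → toℚᵘ (p ÷₀ q) ≃ toℚᵘ p *ᵘ d // x
toℚᵘ-÷₀ p q x@(suc _) d@(suc _) q≃x/d = begin
  r                                ≈⟨ ℚᵘ.*-identityʳ r ⟨
  r *ᵘ 1ℚᵘ                         ≈⟨ *-congˡ {r} x/d*d/x≃1 ⟨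
  r *ᵘ (x // d *ᵘ d // x)          ≈⟨ *-congˡ {r} (*-congʳ {d // x} q≃x/d) ⟨
  r *ᵘ (toℚᵘ q *ᵘ d // x)          ≈⟨ ℚᵘ.*-assoc r (toℚᵘ q) (d // x) ⟨
  r *ᵘ toℚᵘ q *ᵘ d // x            ≈⟨ *-congʳ (toℚᵘ-homo-* (p ÷₀ q) q) ⟨
  toℚᵘ ((p ÷₀ q) * q) *ᵘ d // x    ≡⟨ cong (λ s → toℚᵘ s *ᵘ d // x) (÷₀-*-cancel p q q≢0) ⟩
  toℚᵘ p *ᵘ d // x                 ∎
  where
  open ℚᵘ.≃-Reasoning
  r = toℚᵘ (p ÷₀ q)
  x/d*d/x≃1 : x // d *ᵘ d // x ≃ 1ℚᵘ
  x/d*d/x≃1 = ≃-trans (*-// x d d x) (//-cong (d ℕ.* x) 1 {{ℕ.m*n≢0 d x}} (identity x d))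
    where
    identity : ∀ x d → x ℕ.* d ℕ.* 1 ≡ 1 ℕ.* (d ℕ.* x)
    identity = solve-∀
  q≢0 : q ≢ 0ℚ
  q≢0 q≡0 = 0≄x/d (subst (λ s → toℚᵘ s ≃ x // d) q≡0 q≃x/d)
    where
    0≄x/d : ¬ (0ℚᵘ ≃ x // d)
    0≄x/d (*≡* ())

ratio : (p q : ℕ) → ℚ
ratio p q = ((+ p) / 1) ÷₀ ((+ q) / 1)

-- the right-hand side of the theorem, with p = ⟨b_1,…,b_k⟩, g = ⟨c_1,…,c_k⟩, p′ and g′ the same
-- for k - 1, and γ = c_{k+1}
bound : (p g p′ g′ γ : ℕ) → ℚ
bound p g p′ g′ γ =
  1ℚ + ((((+ p) / 1) - ((+ g) / 1) + (((+ p′) / 1) - ((+ g′) / 1)) * ((+ 1) / suc γ))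
        ÷₀ (((+ g) / 1) + ((+ g′) / 1) * (1ℚ ÷₀ ((+ γ) / 1))))

toℚᵘ-ratio : ∀ p q .{{_ : NonZero q}} → toℚᵘ (ratio p q) ≃ p // q
toℚᵘ-ratio p q = begin
  toℚᵘ (ratio p q)                ≈⟨ toℚᵘ-÷₀ ((+ p) / 1) ((+ q) / 1) q 1 (toℚᵘ-/1 q) ⟩
  toℚᵘ ((+ p) / 1) *ᵘ 1 // q      ≈⟨ *-congʳ (toℚᵘ-/1 p) ⟩
  p // 1 *ᵘ 1 // q                ≈⟨ *-1// p q ⟩
  p // q                          ∎
  where open ℚᵘ.≃-Reasoning

excessDen-nonZero : ∀ g g′ γ .{{_ : NonZero g}} .{{_ : NonZero γ}} → NonZero (excessDen g g′ γ)
excessDen-nonZero (suc _) _ (suc _) = _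

toℚᵘ-bound : ∀ P g Q g′ γ .{{_ : NonZero g}} .{{_ : NonZero γ}} →
  let E = excessDen g g′ γ in
  toℚᵘ (bound (g ℕ.+ P) g (g′ ℕ.+ Q) g′ γ) ≃ ((E ℕ.+ excessNum P Q γ) // E) {{excessDen-nonZero g g′ γ}}
toℚᵘ-bound P g@(suc _) Q g′ γ@(suc _) = begin
  toℚᵘ (1ℚ + num ÷₀ den)                             ≈⟨ toℚᵘ-homo-+ 1ℚ (num ÷₀ den) ⟩
  1ℚᵘ +ᵘ toℚᵘ (num ÷₀ den)                           ≈⟨ +-congʳ 1ℚᵘ (toℚᵘ-÷₀ num den B γ toℚᵘ-den) ⟩
  1ℚᵘ +ᵘ toℚᵘ num *ᵘ γ // B                          ≈⟨ +-congʳ 1ℚᵘ (*-congʳ toℚᵘ-num) ⟩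
  1ℚᵘ +ᵘ A // suc γ *ᵘ γ // B                        ≈⟨ +-congʳ 1ℚᵘ (*-// A (suc γ) γ B) ⟩
  1ℚᵘ +ᵘ N // E                                      ≈⟨ +-//1 1 N E ⟩
  (1 ℕ.* E ℕ.+ N) // E                               ≈⟨ //-cong E E (cong (λ z → (z ℕ.+ N) ℕ.* E) (ℕ.*-identityˡ E)) ⟩
  (E ℕ.+ N) // E                                     ∎
  where
  open ℚᵘ.≃-Reasoning
  E = excessDen g g′ γ
  N = excessNum P Q γ
  A = P ℕ.* suc γ ℕ.+ Q
  B = g ℕ.* γ ℕ.+ g′
  diff diff′ u v : ℚ
  diff  = ((+ (g ℕ.+ P)) / 1) - ((+ g) / 1)
  diff′ = ((+ (g′ ℕ.+ Q)) / 1) - ((+ g′) / 1)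
  u = (+ 1) / suc γ
  v = 1ℚ ÷₀ ((+ γ) / 1)
  num den : ℚ
  num = diff + diff′ * u
  den = (+ g) / 1 + (+ g′) / 1 * v
  toℚᵘ-diff : ∀ x y → toℚᵘ (((+ (x ℕ.+ y)) / 1) - ((+ x) / 1)) ≃ y // 1
  toℚᵘ-diff x y = begin
    toℚᵘ (((+ (x ℕ.+ y)) / 1) - ((+ x) / 1))         ≈⟨ toℚᵘ-homo-sub ((+ (x ℕ.+ y)) / 1) ((+ x) / 1) ⟩
    toℚᵘ ((+ (x ℕ.+ y)) / 1) -ᵘ toℚᵘ ((+ x) / 1)     ≈⟨ +-cong (toℚᵘ-/1 (x ℕ.+ y)) (ℚᵘ.-‿cong (toℚᵘ-/1 x)) ⟩
    (x ℕ.+ y) // 1 -ᵘ x // 1                         ≈⟨ -// x y ⟩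
    y // 1                                           ∎
  toℚᵘ-num : toℚᵘ num ≃ A // suc γ
  toℚᵘ-num = begin
    toℚᵘ (diff + diff′ * u)                  ≈⟨ toℚᵘ-homo-+ diff (diff′ * u) ⟩
    toℚᵘ diff +ᵘ toℚᵘ (diff′ * u)            ≈⟨ +-cong (toℚᵘ-diff g P) (toℚᵘ-homo-* diff′ u) ⟩
    P // 1 +ᵘ toℚᵘ diff′ *ᵘ toℚᵘ u           ≈⟨ +-congʳ (P // 1)
                                                  (*-cong (toℚᵘ-diff g′ Q) (toℚᵘ-fromℚᵘ (1 // suc γ))) ⟩
    P // 1 +ᵘ Q // 1 *ᵘ 1 // suc γ           ≈⟨ +-congʳ (P // 1) (*-1// Q (suc γ)) ⟩
    P // 1 +ᵘ Q // suc γ                     ≈⟨ +-//1 P Q (suc γ) ⟩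
    A // suc γ                               ∎
  toℚᵘ-den : toℚᵘ den ≃ B // γ
  toℚᵘ-den = begin
    toℚᵘ ((+ g) / 1 + (+ g′) / 1 * v)                ≈⟨ toℚᵘ-homo-+ ((+ g) / 1) ((+ g′) / 1 * v) ⟩
    toℚᵘ ((+ g) / 1) +ᵘ toℚᵘ ((+ g′) / 1 * v)        ≈⟨ +-cong (toℚᵘ-/1 g) (toℚᵘ-homo-* ((+ g′) / 1) v) ⟩
    g // 1 +ᵘ toℚᵘ ((+ g′) / 1) *ᵘ toℚᵘ v            ≈⟨ +-congʳ (g // 1)
                                                          (*-cong (toℚᵘ-/1 g′) (toℚᵘ-ratio 1 γ)) ⟩
    g // 1 +ᵘ g′ // 1 *ᵘ 1 // γ                      ≈⟨ +-congʳ (g // 1) (*-1// g′ γ) ⟩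
    g // 1 +ᵘ g′ // γ                                ≈⟨ +-//1 g g′ γ ⟩
    B // γ                                           ∎

bound≤ratio : ∀ p g p′ g′ γ bn cn .{{_ : NonZero g}} .{{_ : NonZero γ}} .{{_ : NonZero cn}} →
  g ℕ.≤ p → g′ ℕ.≤ p′ →
  (excessDen g g′ γ ℕ.+ excessNum (p ∸ g) (p′ ∸ g′) γ) ℕ.* cn ℕ.≤ bn ℕ.* excessDen g g′ γ →
  bound p g p′ g′ γ ≤ ratio bn cn
bound≤ratio p g p′ g′ γ bn cn g≤p g′≤p′ le =
  subst₂ (λ x y → bound x g y g′ γ ≤ ratio bn cn) (ℕ.m+[n∸m]≡n g≤p) (ℕ.m+[n∸m]≡n g′≤p′) bound≤ratio′
  where
  open ℚᵘ.≤-Reasoning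
  P = p ∸ g
  Q = p′ ∸ g′
  E = excessDen g g′ γ
  instance _ = excessDen-nonZero g g′ γ
  bound≤ratio′ : bound (g ℕ.+ P) g (g′ ℕ.+ Q) g′ γ ≤ ratio bn cn
  bound≤ratio′ = toℚᵘ-cancel-≤ (begin
    toℚᵘ (bound (g ℕ.+ P) g (g′ ℕ.+ Q) g′ γ)  ≃⟨ toℚᵘ-bound P g Q g′ γ ⟩
    (E ℕ.+ excessNum P Q γ) // E              ≤⟨ //-mono E cn le ⟩
    bn // cn                                  ≃⟨ toℚᵘ-ratio bn cn ⟨
    toℚᵘ (ratio bn cn)                        ∎)

lemma1 : (b c : ℕ → ℕ) →
         (∀ i → 1 ℕ.≤ i → 1 ℕ.≤ c i) →
         (∀ i → 1 ℕ.≤ i → 1 ℕ.≤ b i) →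
         (∀ i → 1 ℕ.≤ i → c i ℕ.≤ b i) →
         (n k : ℕ) → 2 ℕ.≤ n → 1 ℕ.≤ k → k ℕ.≤ n ∸ 1 →
         1ℚ + ((((+ cont b k) / 1) - ((+ cont c k) / 1)
                + (((+ cont b (k ∸ 1)) / 1) - ((+ cont c (k ∸ 1)) / 1))
                  * ((+ 1) / suc (c (suc k))))
               ÷₀ (((+ cont c k) / 1)
                   + ((+ cont c (k ∸ 1)) / 1) * (1ℚ ÷₀ ((+ c (suc k)) / 1))))
           ≤ (((+ cont b n) / 1) ÷₀ ((+ cont c n) / 1))
-- positivity of b is implied by b ≥ c ≥ 1
lemma1 b c c>0 _ c≼b (suc (suc n)) k@(suc k′) _ _ k≤n-1 =
  subst (λ n → bound′ ≤ ratio (cont b n) (cont c n)) (cong suc (ℕ.m∸n+n≡m k≤n-1))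
        (bound≤ratio _ _ _ _ _ (cont b m) (cont c m) g≤p g′≤p′ (cont-excess-bound c>0 c≼b k t))
  where
  bound′ : ℚ
  bound′ = bound (cont b k) (cont c k) (cont b k′) (cont c k′) (c (suc k))
  t = suc n ∸ k
  m = suc t ℕ.+ k
  g≤p : cont c k ℕ.≤ cont b k
  g≤p = proj₁ (contPair-mono c≼b k)
  g′≤p′ : cont c k′ ℕ.≤ cont b k′
  g′≤p′ = proj₂ (contPair-mono c≼b k)
  instance
    _ = >-nonZero (cont-pos c>0 k)
    _ = >-nonZero (c>0 (suc k) (s≤s z≤n))
    _ = >-nonZero (cont-pos c>0 m)
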